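{- Let $M$ be a finite semilattice with separated equalizers, and let $p$ be an irreducible object of $M$ with predecessor $q$. Then $|N(p)\setminus N(q)|=1$.
   Context: A semilattice here is a commutative monoid (written multiplicatively, with identity) in which every element satisfies $x^2=x$; $x\mid y$ means $xz=y$ for some $z$. An object $p$ is irreducible if $p=yz$ implies $p=y$ or $p=z$; a predecessor of $p$ is an object $q\neq p$ with $q\mid p$ such that every $x$ with $x\mid p$ satisfies $x=p$ or $x\mid q$. An object $s$ is singular if there is $t\neq s$ with $s\mid t$ such that every $x$ with $s\mid x$ satisfies $x=s$ or $t\mid x$. For an object $x$, $N(x)$ is the set of singular objects $s$ with $x\nmid s$. An equalizing pair is a pair $x,y$ with $x\mid y$ for which there exist $a,b$ with $xa\neq xb$, $xa\neq ya$, $ya=yb$, $yb\neq xb$; $M$ has separated equalizers if for each equalizing pair $x,y$ there is $z$ with $x\mid z\mid y$, $z\neq x$, $z\neq y$. -}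

module Defs where

open import Data.Nat using (ℕ)
open import Data.Fin using (Fin)
open import Data.Product using (Σ; ∃; ∃-syntax; _×_; _,_)
open import Data.Sum using (_⊎_)
open import Relation.Nullary using (¬_)
open import Relation.Binary.PropositionalEquality using (_≡_; _≢_)
open import Function.Bundles using (_↔_)

record Semilattice : Set₁ where
  infixl 7 _∙_
  field
    Carrier  : Set
    _∙_      : Carrier → Carrier → Carrier
    ε        : Carrier
    assoc    : ∀ x y z → (x ∙ y) ∙ z ≡ x ∙ (y ∙ z)
    comm     : ∀ x y → x ∙ y ≡ y ∙ x
    identityˡ : ∀ x → ε ∙ x ≡ x
    idem     : ∀ x → x ∙ x ≡ x

module _ (M : Semilattice) where
  open Semilattice M

  Finite : Set
  Finite = ∃[ n ] (Carrier ↔ Fin n)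

  _∣_ : Carrier → Carrier → Set
  x ∣ y = ∃[ z ] (x ∙ z ≡ y)

  Irreducible : Carrier → Set
  Irreducible p = ∀ y z → p ≡ y ∙ z → (p ≡ y) ⊎ (p ≡ z)

  Predecessor : Carrier → Carrier → Set
  Predecessor q p = (q ≢ p) × (q ∣ p) × (∀ x → x ∣ p → (x ≡ p) ⊎ (x ∣ q))

  Singular : Carrier → Set
  Singular s = ∃[ t ] ((t ≢ s) × (s ∣ t) × (∀ x → s ∣ x → (x ≡ s) ⊎ (t ∣ x)))

  N : Carrier → Carrier → Set
  N x s = Singular s × ¬ (x ∣ s)

  EqualizingPair : Carrier → Carrier → Set
  EqualizingPair x y =
    (x ∣ y) × ∃[ a ] ∃[ b ]
      ((x ∙ a ≢ x ∙ b) × (x ∙ a ≢ y ∙ a) × (y ∙ a ≡ y ∙ b) × (y ∙ b ≢ x ∙ b))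

  SeparatedEqualizers : Set
  SeparatedEqualizers = ∀ x y → EqualizingPair x y →
    ∃[ z ] ((x ∣ z) × (z ∣ y) × (z ≢ x) × (z ≢ y))

  ExactlyOne : (Carrier → Set) → Set
  ExactlyOne P = ∃[ s ] (P s × (∀ t → P t → t ≡ s))

-- Order M by x ≼ y ⇔ x ∙ y ≡ y (i.e. x ∣ y), so that a predecessor q of p is a
-- cover q ⋖ p.  Separated equalizers say exactly that y ∙_ is injective on the
-- elements above x but not above y whenever x ⋖ y.  By an upward induction in
-- the finite semilattice, this makes the set of elements above q and not above p
-- closed under ∙, so it has a largest element m.  Every element of
-- N(p) ∖ N(q) lies in that set; m is singular with successor p ∙ m, and any
-- singular s in the set lies below m while injectivity forces its successor
-- above p, which leaves s ≡ m.
module Submission where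

open import Defs
open import Data.Product using (_×_; _,_; proj₁; proj₂; ∃)
open import Data.Sum using (_⊎_; inj₁; inj₂)
open import Data.Empty using (⊥-elim)
import Data.Fin.Properties as Fin
open import Data.Fin.Induction using (spo-wellFounded; spo-noetherian)
open import Function.Base using (flip; _∘_)
open import Function.Bundles using (Inverse)
open import Function.Properties.Inverse using (↔⇒↣)
open import Induction.WellFounded using (WellFounded; Acc; acc; module Subrelation)
import Relation.Binary.Construct.On as On
open import Relation.Binary.Definitions using (DecidableEquality)
open import Relation.Binary.Structures using (IsStrictPartialOrder)
open import Relation.Nullary using (¬_; Dec; yes; no)
open import Relation.Nullary.Decidable using (map′; ¬?; _×-dec_; via-injection)
open import Relation.Unary using (Decidable)
open import Relation.Binary.PropositionalEquality
open ≡-Reasoning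

module SemilatticeOrder (M : Semilattice) where
  open Semilattice M

  infix 4 _≼_ _≺_ _⋖_

  _≼_ : Carrier → Carrier → Set
  x ≼ y = x ∙ y ≡ y

  _≺_ : Carrier → Carrier → Set
  x ≺ y = x ≼ y × x ≢ y

  _⋖_ : Carrier → Carrier → Set
  x ⋖ y = x ≼ y × x ≢ y × (∀ z → x ≼ z → z ≼ y → z ≡ x ⊎ z ≡ y)

  ∣⇒≼ : ∀ {x y} → _∣_ M x y → x ≼ y
  ∣⇒≼ {x} {y} (z , xz≡y) = begin
    x ∙ y        ≡⟨ cong (x ∙_) (sym xz≡y) ⟩
    x ∙ (x ∙ z)  ≡⟨ assoc x x z ⟨
    (x ∙ x) ∙ z  ≡⟨ cong (_∙ z) (idem x) ⟩
    x ∙ z        ≡⟨ xz≡y ⟩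
    y            ∎

  ≼⇒∣ : ∀ {x y} → x ≼ y → _∣_ M x y
  ≼⇒∣ {y = y} x≼y = y , x≼y

  ≼-refl : ∀ x → x ≼ x
  ≼-refl = idem

  ≼-trans : ∀ {x y z} → x ≼ y → y ≼ z → x ≼ z
  ≼-trans {x} {y} {z} x≼y y≼z = begin
    x ∙ z        ≡⟨ cong (x ∙_) y≼z ⟨
    x ∙ (y ∙ z)  ≡⟨ assoc x y z ⟨
    (x ∙ y) ∙ z  ≡⟨ cong (_∙ z) x≼y ⟩
    y ∙ z        ≡⟨ y≼z ⟩
    z            ∎

  ≼-antisym : ∀ {x y} → x ≼ y → y ≼ x → x ≡ y
  ≼-antisym {x} {y} x≼y y≼x = trans (sym y≼x) (trans (comm y x) x≼y)

  x≼x∙y : ∀ x y → x ≼ x ∙ y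
  x≼x∙y x y = trans (sym (assoc x x y)) (cong (_∙ y) (idem x))

  y≼x∙y : ∀ x y → y ≼ x ∙ y
  y≼x∙y x y = subst (y ≼_) (comm y x) (x≼x∙y y x)

  ∙-lub : ∀ {x y z} → x ≼ z → y ≼ z → x ∙ y ≼ z
  ∙-lub {x} {y} {z} x≼z y≼z = trans (assoc x y z) (trans (cong (x ∙_) y≼z) x≼z)

  ≺-isStrictPartialOrder : IsStrictPartialOrder _≡_ _≺_
  ≺-isStrictPartialOrder = record
    { isEquivalence = isEquivalence
    ; irrefl        = λ { refl (_ , x≢x) → x≢x refl }
    ; trans         = λ { (x≼y , x≢y) (y≼z , _) →
                            ≼-trans x≼y y≼z
                          , λ { refl → x≢y (≼-antisym x≼y y≼z) } }
    ; <-resp-≈      = (λ { refl x≺y → x≺y }) , (λ { refl x≺y → x≺y })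
    }

  IsMaximal : (Carrier → Set) → Carrier → Set
  IsMaximal P m = P m × (∀ w → m ≼ w → P w → w ≡ m)

  ⋖-between : ∀ {x y} → x ⋖ y → ∀ z → x ≼ z → z ≼ y → z ≡ x ⊎ z ≡ y
  ⋖-between (_ , _ , between) = between

  predecessor⇒⋖ : ∀ {q p} → Predecessor M q p → q ⋖ p
  predecessor⇒⋖ {q} {p} (q≢p , q∣p , below-p) = ∣⇒≼ q∣p , q≢p , between
    where
    between : ∀ z → q ≼ z → z ≼ p → z ≡ q ⊎ z ≡ p
    between z q≼z z≼p with below-p z (≼⇒∣ z≼p)
    ... | inj₁ z≡p = inj₂ z≡p
    ... | inj₂ z∣q = inj₁ (≼-antisym (∣⇒≼ z∣q) q≼z)

module DecidableSemilattice (M : Semilattice)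
  (_≟_ : DecidableEquality (Semilattice.Carrier M)) where
  open Semilattice M
  open SemilatticeOrder M

  _≼?_ : ∀ x y → Dec (x ≼ y)
  x ≼? y = (x ∙ y) ≟ y

  _≺?_ : ∀ x y → Dec (x ≺ y)
  x ≺? y = (x ≼? y) ×-dec ¬? (x ≟ y)

  maximal-avoider-singular : ∀ {p m} → IsMaximal (λ w → ¬ p ≼ w) m → Singular M m
  maximal-avoider-singular {p} {m} (p⋠m , maximal) =
    p ∙ m , p⋠m , (p , comm m p) , above-m
    where
    above-m : ∀ x → _∣_ M m x → x ≡ m ⊎ _∣_ M (p ∙ m) x
    above-m x m∣x with p ≼? x
    ... | yes p≼x = inj₂ (≼⇒∣ (∙-lub p≼x (∣⇒≼ m∣x)))
    ... | no p⋠x  = inj₁ (maximal x (∣⇒≼ m∣x) p⋠x)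

  module _ (sep : SeparatedEqualizers M) where

    ⋖-cancel : ∀ {x y a b} → x ⋖ y → x ≼ a → x ≼ b → ¬ y ≼ a → ¬ y ≼ b →
      y ∙ a ≡ y ∙ b → a ≡ b
    ⋖-cancel {x} {y} {a} {b} (x≼y , x≢y , between) x≼a x≼b y⋠a y⋠b ya≡yb
      with a ≟ b
    ... | yes a≡b = a≡b
    ... | no a≢b with sep x y (≼⇒∣ x≼y , a , b , xa≢xb , xa≢ya , ya≡yb , yb≢xb)
      where
      xa≢xb : x ∙ a ≢ x ∙ b
      xa≢xb xa≡xb = a≢b (trans (sym x≼a) (trans xa≡xb x≼b))
      xa≢ya : x ∙ a ≢ y ∙ a
      xa≢ya xa≡ya = y⋠a (sym (trans (sym x≼a) xa≡ya))
      yb≢xb : y ∙ b ≢ x ∙ b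
      yb≢xb yb≡xb = y⋠b (trans yb≡xb x≼b)
    ... | z , x∣z , z∣y , z≢x , z≢y with between z (∣⇒≼ x∣z) (∣⇒≼ z∣y)
    ...   | inj₁ z≡x = ⊥-elim (z≢x z≡x)
    ...   | inj₂ z≡y = ⊥-elim (z≢y z≡y)

    ⋖-translate : ∀ {x y c} → x ⋖ y → x ≼ c → ¬ y ≼ c → c ⋖ y ∙ c
    ⋖-translate {x} {y} {c} x⋖y x≼c y⋠c = y≼x∙y y c , y⋠c ∘ sym , between
      where
      between : ∀ w → c ≼ w → w ≼ y ∙ c → w ≡ c ⊎ w ≡ y ∙ c
      between w c≼w w≼yc with y ≼? w
      ... | yes y≼w = inj₂ (≼-antisym w≼yc (∙-lub y≼w c≼w))
      ... | no y⋠w  = inj₁ (sym (⋖-cancel x⋖y x≼c (≼-trans x≼c c≼w) y⋠c y⋠w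
                          (≼-antisym (∙-lub (x≼x∙y y w) (≼-trans c≼w (y≼x∙y y w)))
                                     (∙-lub (x≼x∙y y c) w≼yc))))

    ⋖-distinct-incomparable : ∀ {x c d} → x ⋖ c → x ⋖ d → c ≢ d → ¬ d ≼ c
    ⋖-distinct-incomparable (_ , _ , between) (x≼d , x≢d , _) c≢d d≼c
      with between _ x≼d d≼c
    ... | inj₁ d≡x = x≢d (sym d≡x)
    ... | inj₂ d≡c = c≢d (sym d≡c)

    -- If y ≼ c ∙ d, then y ∙ c and y ∙ d both equal c ∙ d, since c ∙ d covers c and d.
    ⋖-covers-∙-avoid : ∀ {x y c d} → x ⋖ y → x ⋖ c → x ⋖ d → ¬ y ≼ c → ¬ y ≼ d →
      ¬ y ≼ c ∙ d
    ⋖-covers-∙-avoid {x} {y} {c} {d} x⋖y x⋖c x⋖d y⋠c y⋠d y≼cd with c ≟ d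
    ... | yes refl = y⋠c (subst (y ≼_) (idem c) y≼cd)
    ... | no c≢d = c≢d (⋖-cancel x⋖y (proj₁ x⋖c) (proj₁ x⋖d) y⋠c y⋠d yc≡yd)
      where
      yc≡dc : y ∙ c ≡ d ∙ c
      yc≡dc with ⋖-between (⋖-translate x⋖d (proj₁ x⋖c) (⋖-distinct-incomparable x⋖c x⋖d c≢d))
                   (y ∙ c) (y≼x∙y y c) (∙-lub (subst (y ≼_) (comm c d) y≼cd) (y≼x∙y d c))
      ... | inj₁ yc≡c  = ⊥-elim (y⋠c yc≡c)
      ... | inj₂ yc≡dc = yc≡dc
      yd≡cd : y ∙ d ≡ c ∙ d
      yd≡cd with ⋖-between (⋖-translate x⋖c (proj₁ x⋖d)
                           (⋖-distinct-incomparable x⋖d x⋖c (c≢d ∘ sym)))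
                   (y ∙ d) (y≼x∙y y d) (∙-lub y≼cd (y≼x∙y c d))
      ... | inj₁ yd≡d  = ⊥-elim (y⋠d yd≡d)
      ... | inj₂ yd≡cd = yd≡cd
      yc≡yd : y ∙ c ≡ y ∙ d
      yc≡yd = trans yc≡dc (trans (comm d c) (sym yd≡cd))

    singular-successor-above-⋖ : ∀ {x y s} → x ⋖ y → x ≼ s → ¬ y ≼ s →
      (s-singular : Singular M s) → y ≼ proj₁ s-singular
    singular-successor-above-⋖ {x} {y} {s} x⋖y x≼s y⋠s (t , t≢s , s∣t , above-s)
      with y ≼? t
    ... | yes y≼t = y≼t
    ... | no y⋠t = ⊥-elim (t≢s (sym (⋖-cancel x⋖y x≼s (≼-trans x≼s s≼t) y⋠s y⋠t ys≡yt)))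
      where
      s≼t : s ≼ t
      s≼t = ∣⇒≼ s∣t
      t≼ys : t ≼ y ∙ s
      t≼ys with above-s (y ∙ s) (≼⇒∣ (y≼x∙y y s))
      ... | inj₁ ys≡s = ⊥-elim (y⋠s ys≡s)
      ... | inj₂ t∣ys = ∣⇒≼ t∣ys
      ys≡yt : y ∙ s ≡ y ∙ t
      ys≡yt = ≼-antisym (∙-lub (x≼x∙y y t) (≼-trans s≼t (y≼x∙y y t)))
                        (∙-lub (x≼x∙y y s) t≼ys)

module FiniteSemilattice (M : Semilattice) (fin : Finite M) where
  open Semilattice M
  open SemilatticeOrder M
  open Inverse (proj₂ fin) using (to; from; strictlyInverseʳ)

  _≟_ : DecidableEquality Carrier
  _≟_ = via-injection (↔⇒↣ (proj₂ fin)) Fin._≟_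

  open DecidableSemilattice M _≟_ public

  ∃? : ∀ {P : Carrier → Set} → Decidable P → Dec (∃ P)
  ∃? {P} P? = map′ (λ (i , Pi) → from i , Pi)
                   (λ (x , Px) → to x , subst P (sym (strictlyInverseʳ x)) Px)
                   (Fin.any? (P? ∘ from))

  from∘to-resp-≺ : ∀ {x y} → x ≺ y → from (to x) ≺ from (to y)
  from∘to-resp-≺ {x} {y} = subst₂ _≺_ (sym (strictlyInverseʳ x)) (sym (strictlyInverseʳ y))

  ≺-wellFounded : WellFounded _≺_
  ≺-wellFounded = Subrelation.wellFounded from∘to-resp-≺
    (On.wellFounded to (spo-wellFounded (On.isStrictPartialOrder from ≺-isStrictPartialOrder)))

  ≻-wellFounded : WellFounded (flip _≺_)
  ≻-wellFounded = Subrelation.wellFounded from∘to-resp-≺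
    (On.wellFounded to (spo-noetherian (On.isStrictPartialOrder from ≺-isStrictPartialOrder)))

  maximal-above : ∀ {P : Carrier → Set} → Decidable P → ∀ {c} → P c →
    ∃ λ m → c ≼ m × IsMaximal P m
  maximal-above {P} P? = go (≻-wellFounded _)
    where
    go : ∀ {c} → Acc (flip _≺_) c → P c → ∃ λ m → c ≼ m × IsMaximal P m
    go {c} (acc rec) Pc with ∃? (λ w → (c ≺? w) ×-dec P? w)
    ... | yes (w , c≺w , Pw) with go (rec c≺w) Pw
    ...   | m , w≼m , m-maximal = m , ≼-trans (proj₁ c≺w) w≼m , m-maximal
    go {c} (acc rec) Pc | no ∄ = c , ≼-refl c , Pc , maximal
      where
      maximal : ∀ w → c ≼ w → P w → w ≡ c
      maximal w c≼w Pw with w ≟ c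
      ... | yes w≡c = w≡c
      ... | no w≢c  = ⊥-elim (∄ (w , (c≼w , w≢c ∘ sym) , Pw))

  ⋖-below : ∀ {x c} → x ≺ c → ∃ λ x′ → x ⋖ x′ × x′ ≼ c
  ⋖-below {x} = go (≺-wellFounded _)
    where
    go : ∀ {c} → Acc _≺_ c → x ≺ c → ∃ λ x′ → x ⋖ x′ × x′ ≼ c
    go {c} (acc rec) x≺c with ∃? (λ w → (x ≺? w) ×-dec (w ≺? c))
    ... | yes (w , x≺w , w≺c) with go (rec w≺c) x≺w
    ...   | x′ , x⋖x′ , x′≼w = x′ , x⋖x′ , ≼-trans x′≼w (proj₁ w≺c)
    go {c} (acc rec) (x≼c , x≢c) | no ∄ = c , (x≼c , x≢c , between) , ≼-refl c
      where
      between : ∀ z → x ≼ z → z ≼ c → z ≡ x ⊎ z ≡ c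
      between z x≼z z≼c with z ≟ x | z ≟ c
      ... | yes z≡x | _       = inj₁ z≡x
      ... | no _    | yes z≡c = inj₂ z≡c
      ... | no z≢x  | no z≢c  = ⊥-elim (∄ (z , (x≼z , z≢x ∘ sym) , (z≼c , z≢c)))

  module _ (sep : SeparatedEqualizers M) where

    -- Induction upwards from x: after replacing x by covers c′ ≼ c and d′ ≼ d,
    -- the two-covers case ⋖-covers-∙-avoid feeds the hypothesis at c′ and then at d′.
    ⋖-avoiders-∙-closed : ∀ {x y c d} → x ⋖ y → x ≼ c → x ≼ d → ¬ y ≼ c → ¬ y ≼ d →
      ¬ y ≼ c ∙ d
    ⋖-avoiders-∙-closed = go (≻-wellFounded _)
      where
      go : ∀ {x y c d} → Acc (flip _≺_) x → x ⋖ y → x ≼ c → x ≼ d →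
        ¬ y ≼ c → ¬ y ≼ d → ¬ y ≼ c ∙ d
      go {x} {y} {c} {d} (acc rec) x⋖y x≼c x≼d y⋠c y⋠d with x ≟ c | x ≟ d
      ... | yes refl | _ = y⋠d ∘ subst (y ≼_) x≼d
      ... | no _ | yes refl = y⋠c ∘ subst (y ≼_) (trans (comm c x) x≼c)
      ... | no x≢c | no x≢d
        with ⋖-below (x≼c , x≢c) | ⋖-below (x≼d , x≢d)
      ... | c′ , x⋖c′ , c′≼c | d′ , x⋖d′ , d′≼d = y⋠cd
        where
        y∙-⋠ : ∀ {z w} → ¬ y ≼ w → ¬ y ∙ z ≼ w
        y∙-⋠ {z} y⋠w = y⋠w ∘ ≼-trans (x≼x∙y y z)

        y⋠c′ : ¬ y ≼ c′
        y⋠c′ = y⋠c ∘ flip ≼-trans c′≼c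

        y⋠d′ : ¬ y ≼ d′
        y⋠d′ = y⋠d ∘ flip ≼-trans d′≼d

        y⋠c′d′ : ¬ y ≼ c′ ∙ d′
        y⋠c′d′ = ⋖-covers-∙-avoid sep x⋖y x⋖c′ x⋖d′ y⋠c′ y⋠d′

        cd′≡c[c′d′] : c ∙ d′ ≡ c ∙ (c′ ∙ d′)
        cd′≡c[c′d′] = begin
          c ∙ d′         ≡⟨ cong (_∙ d′) (trans (comm c c′) c′≼c) ⟨
          (c ∙ c′) ∙ d′  ≡⟨ assoc c c′ d′ ⟩
          c ∙ (c′ ∙ d′)  ∎

        cd≡[cd′]d : c ∙ d ≡ (c ∙ d′) ∙ d
        cd≡[cd′]d = begin
          c ∙ d         ≡⟨ cong (c ∙_) d′≼d ⟨
          c ∙ (d′ ∙ d)  ≡⟨ assoc c d′ d ⟨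
          (c ∙ d′) ∙ d  ∎

        y⋠cd′ : ¬ y ≼ c ∙ d′
        y⋠cd′ y≼cd′ =
          go (rec (proj₁ x⋖c′ , proj₁ (proj₂ x⋖c′)))
             (⋖-translate sep x⋖y (proj₁ x⋖c′) y⋠c′) c′≼c (x≼x∙y c′ d′)
             (y∙-⋠ y⋠c) (y∙-⋠ y⋠c′d′)
             (subst (y ∙ c′ ≼_) cd′≡c[c′d′] (∙-lub y≼cd′ (≼-trans c′≼c (x≼x∙y c d′))))

        y⋠cd : ¬ y ≼ c ∙ d
        y⋠cd y≼cd =
          go (rec (proj₁ x⋖d′ , proj₁ (proj₂ x⋖d′)))
             (⋖-translate sep x⋖y (proj₁ x⋖d′) y⋠d′) (y≼x∙y c d′) d′≼d
             (y∙-⋠ y⋠cd′) (y∙-⋠ y⋠d)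
             (subst (y ∙ d′ ≼_) cd≡[cd′]d (∙-lub y≼cd (≼-trans d′≼d (y≼x∙y c d))))

    singular-avoider-≡-maximal : ∀ {x y m s} → x ⋖ y → x ≼ m →
      IsMaximal (λ w → ¬ y ≼ w) m → x ≼ s → ¬ y ≼ s → Singular M s → s ≡ m
    singular-avoider-≡-maximal {x} {y} {m} {s} x⋖y x≼m (y⋠m , maximal) x≼s y⋠s
      s-singular@(t , _ , _ , above-s)
      with above-s m (≼⇒∣ s≼m)
      where
      s≼m : s ≼ m
      s≼m = maximal (s ∙ m) (y≼x∙y s m) (⋖-avoiders-∙-closed x⋖y x≼s x≼m y⋠s y⋠m)
    ... | inj₁ m≡s = sym m≡s
    ... | inj₂ t∣m =
      ⊥-elim (y⋠m (≼-trans (singular-successor-above-⋖ sep x⋖y x≼s y⋠s s-singular)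
                           (∣⇒≼ t∣m)))

mainTheorem15 : (M : Semilattice) → Finite M → SeparatedEqualizers M →
    (p q : Semilattice.Carrier M) → Irreducible M p → Predecessor M q p →
    ExactlyOne M (λ s → N M p s × ¬ N M q s)
mainTheorem15 M fin sep p q _ q-pred-p = m , (m∈N[p] , m∉N[q]) , only-m
  where
  open Semilattice M using (Carrier)
  open SemilatticeOrder M
  open FiniteSemilattice M fin

  q⋖p : q ⋖ p
  q⋖p = predecessor⇒⋖ q-pred-p

  p⋠q : ¬ p ≼ q
  p⋠q p≼q = proj₁ (proj₂ q⋖p) (≼-antisym (proj₁ q⋖p) p≼q)

  maximal-avoider : ∃ λ m → q ≼ m × IsMaximal (λ w → ¬ p ≼ w) m
  maximal-avoider = maximal-above (λ w → ¬? (p ≼? w)) p⋠q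

  m : Carrier
  m = proj₁ maximal-avoider

  q≼m : q ≼ m
  q≼m = proj₁ (proj₂ maximal-avoider)

  m-maximal : IsMaximal (λ w → ¬ p ≼ w) m
  m-maximal = proj₂ (proj₂ maximal-avoider)

  m∈N[p] : N M p m
  m∈N[p] = maximal-avoider-singular m-maximal , proj₁ m-maximal ∘ ∣⇒≼

  m∉N[q] : ¬ N M q m
  m∉N[q] (_ , q∤m) = q∤m (≼⇒∣ q≼m)

  above-q : ∀ {s} → Singular M s → ¬ N M q s → q ≼ s
  above-q {s} s-singular s∉N[q] with q ≼? s
  ... | yes q≼s = q≼s
  ... | no q⋠s  = ⊥-elim (s∉N[q] (s-singular , q⋠s ∘ ∣⇒≼))

  only-m : ∀ s → N M p s × ¬ N M q s → s ≡ m
  only-m s ((s-singular , p∤s) , s∉N[q]) =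
    singular-avoider-≡-maximal sep q⋖p q≼m m-maximal
      (above-q s-singular s∉N[q]) (p∤s ∘ ≼⇒∣) s-singular
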